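{- For every positive integer $n$, $$\left|\frac{3\psi(n) + \psi(n+1)}{2^n}\right| \le 1.$$
   Context: The integer sequence $\psi$ is defined by $\psi(0)=1$, $\psi(1)=0$, and $\psi(n) = -2\psi(n-2) - \psi(n-1)$ for $n \ge 2$. -}

module Defs where

open import Data.Nat using (ℕ; zero; suc)
open import Data.Integer using (ℤ; +_; _+_; _*_; -_)

ψ : ℕ → ℤ
ψ zero = + 1
ψ (suc zero) = + 0
ψ (suc (suc n)) = - (+ 2 * ψ n) + - ψ (suc n)

-- The characteristic polynomial x² + x + 2 of the recurrence has complex roots of
-- modulus √2, so the norm form y² + xy + 2x² of consecutive terms of any solution
-- doubles at each step.  For φ n = 3ψ(n) + ψ(n+1) it starts at 16, and since
-- 4(y² + xy + 2x²) = (2y + x)² + 7x² this gives 7φ(n)² ≤ 64·2ⁿ, which is below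
-- 7·4ⁿ once n ≥ 4.  The cases n = 1, 2, 3 are computed directly.
module Submission where

open import Defs
open import Data.Nat using (ℕ; suc; _≤_; _^_)
open import Data.Integer using (ℤ; +_; -[1+_]; _+_; _*_; -_; ∣_∣)
open import Data.Integer.Tactic.RingSolver using (solve-∀)
import Data.Integer.Properties as ℤ
import Data.Nat as ℕ
import Data.Nat.Properties as ℕ
open import Relation.Binary.PropositionalEquality

Recurrent : (ℕ → ℤ) → Set
Recurrent u = ∀ n → u (suc (suc n)) ≡ - (+ 2 * u n) + - u (suc n)

ψ-recurrent : Recurrent ψ
ψ-recurrent n = refl

recurrent-+-shift : ∀ c {u} → Recurrent u → Recurrent (λ n → c * u n + u (suc n))
recurrent-+-shift c {u} rec n
  rewrite rec (suc n) | rec n = identity c (u n) (u (suc n))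
  where
  identity : ∀ c p q →
    c * (- (+ 2 * p) + - q) + (- (+ 2 * q) + - (- (+ 2 * p) + - q))
      ≡ - (+ 2 * (c * p + q)) + - (c * q + (- (+ 2 * p) + - q))
  identity = solve-∀

norm : ℤ → ℤ → ℤ
norm x y = y * y + y * x + + 2 * (x * x)

norm-step : ∀ x y → norm y (- (+ 2 * x) + - y) ≡ + 2 * norm x y
norm-step = expanded
  where
  expanded : ∀ x y → let y′ = - (+ 2 * x) + - y in
             y′ * y′ + y′ * y + + 2 * (y * y) ≡ + 2 * (y * y + y * x + + 2 * (x * x))
  expanded = solve-∀

norm-recurrent : ∀ {u} → Recurrent u → ∀ n →
                 norm (u n) (u (suc n)) ≡ + (2 ^ n) * norm (u 0) (u 1)
norm-recurrent {u} rec ℕ.zero = sym (ℤ.*-identityˡ (norm (u 0) (u 1)))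
norm-recurrent {u} rec (suc n) = begin
  norm (u (suc n)) (u (suc (suc n)))   ≡⟨ cong (norm (u (suc n))) (rec n) ⟩
  norm (u (suc n)) (- (+ 2 * u n) + - u (suc n))
                                       ≡⟨ norm-step (u n) (u (suc n)) ⟩
  + 2 * norm (u n) (u (suc n))         ≡⟨ cong (+ 2 *_) (norm-recurrent {u} rec n) ⟩
  + 2 * (+ (2 ^ n) * norm (u 0) (u 1)) ≡⟨ ℤ.*-assoc (+ 2) (+ (2 ^ n)) (norm (u 0) (u 1)) ⟨
  + 2 * + (2 ^ n) * norm (u 0) (u 1)   ≡⟨ cong (_* norm (u 0) (u 1)) (ℤ.pos-* 2 (2 ^ n)) ⟨
  + (2 ^ suc n) * norm (u 0) (u 1)     ∎
  where open ≡-Reasoning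

i*i≡∣i∣*∣i∣ : ∀ i → i * i ≡ + (∣ i ∣ ℕ.* ∣ i ∣)
i*i≡∣i∣*∣i∣ (+ n)    = ℤ.+◃n≡+n (n ℕ.* n)
i*i≡∣i∣*∣i∣ -[1+ n ] = ℤ.+◃n≡+n (suc n ℕ.* suc n)

7*x*x≤4*norm : ∀ x y → 7 ℕ.* (∣ x ∣ ℕ.* ∣ x ∣) ≤ 4 ℕ.* ∣ norm x y ∣
7*x*x≤4*norm x y =
  subst (7 ℕ.* (∣ x ∣ ℕ.* ∣ x ∣) ≤_) sum≡ (ℕ.m≤n+m (7 ℕ.* (∣ x ∣ ℕ.* ∣ x ∣)) (∣ s ∣ ℕ.* ∣ s ∣))
  where
  s = + 2 * y + x
  sum≡ : ∣ s ∣ ℕ.* ∣ s ∣ ℕ.+ 7 ℕ.* (∣ x ∣ ℕ.* ∣ x ∣) ≡ 4 ℕ.* ∣ norm x y ∣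
  sum≡ = begin
    ∣ s ∣ ℕ.* ∣ s ∣ ℕ.+ 7 ℕ.* (∣ x ∣ ℕ.* ∣ x ∣)
      ≡⟨ cong ∣_∣ (ℤ.pos-+ (∣ s ∣ ℕ.* ∣ s ∣) (7 ℕ.* (∣ x ∣ ℕ.* ∣ x ∣))) ⟩
    ∣ + (∣ s ∣ ℕ.* ∣ s ∣) + + (7 ℕ.* (∣ x ∣ ℕ.* ∣ x ∣)) ∣
      ≡⟨ cong₂ (λ p q → ∣ p + q ∣) (i*i≡∣i∣*∣i∣ s) (sym (ℤ.pos-* 7 (∣ x ∣ ℕ.* ∣ x ∣))) ⟨
    ∣ s * s + + 7 * + (∣ x ∣ ℕ.* ∣ x ∣) ∣
      ≡⟨ cong (λ q → ∣ s * s + + 7 * q ∣) (i*i≡∣i∣*∣i∣ x) ⟨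
    ∣ s * s + + 7 * (x * x) ∣
      ≡⟨ cong ∣_∣ (completed-square x y) ⟨
    ∣ + 4 * norm x y ∣
      ≡⟨ ℤ.abs-* (+ 4) (norm x y) ⟩
    4 ℕ.* ∣ norm x y ∣ ∎
    where
    open ≡-Reasoning
    completed-square : ∀ x y → + 4 * (y * y + y * x + + 2 * (x * x))
                                 ≡ (+ 2 * y + x) * (+ 2 * y + x) + + 7 * (x * x)
    completed-square = solve-∀

x*x≤m*m⇒x≤m : ∀ {x m} → x ℕ.* x ≤ m ℕ.* m → x ≤ m
x*x≤m*m⇒x≤m x²≤m² = ℕ.≮⇒≥ λ m<x → ℕ.<⇒≱ (ℕ.*-mono-< m<x m<x) x²≤m²

7*x*x≤64*m⇒x≤m : ∀ {x m} → 10 ≤ m → 7 ℕ.* (x ℕ.* x) ≤ 64 ℕ.* m → x ≤ m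
7*x*x≤64*m⇒x≤m {x} {m} 10≤m bound = x*x≤m*m⇒x≤m (ℕ.*-cancelˡ-≤ 7 (begin
  7 ℕ.* (x ℕ.* x)  ≤⟨ bound ⟩
  64 ℕ.* m         ≤⟨ ℕ.*-monoˡ-≤ m (ℕ.m≤m+n 64 6) ⟩
  7 ℕ.* 10 ℕ.* m   ≡⟨ ℕ.*-assoc 7 10 m ⟩
  7 ℕ.* (10 ℕ.* m) ≤⟨ ℕ.*-monoʳ-≤ 7 (ℕ.*-monoˡ-≤ m 10≤m) ⟩
  7 ℕ.* (m ℕ.* m)  ∎))
  where open ℕ.≤-Reasoning

φ : ℕ → ℤ
φ n = + 3 * ψ n + ψ (suc n)

abs-norm-φ : ∀ n → ∣ norm (φ n) (φ (suc n)) ∣ ≡ 2 ^ n ℕ.* 16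
abs-norm-φ n = trans (cong ∣_∣ (norm-recurrent {φ} (recurrent-+-shift (+ 3) {ψ} ψ-recurrent) n))
                 (ℤ.abs-* (+ (2 ^ n)) (+ 16))

lemma5p1 : ∀ (n : ℕ) → 1 ≤ n → ∣ + 3 * ψ n + ψ (suc n) ∣ ≤ 2 ^ n
lemma5p1 1 _ = ℕ.≤-refl
lemma5p1 2 _ = ℕ.≤-refl
lemma5p1 3 _ = ℕ.≤-refl
lemma5p1 n@(suc (suc (suc (suc k)))) _ = 7*x*x≤64*m⇒x≤m 10≤2^n (begin
  7 ℕ.* (∣ φ n ∣ ℕ.* ∣ φ n ∣)      ≤⟨ 7*x*x≤4*norm (φ n) (φ (suc n)) ⟩
  4 ℕ.* ∣ norm (φ n) (φ (suc n)) ∣ ≡⟨ cong (4 ℕ.*_) (abs-norm-φ n) ⟩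
  4 ℕ.* (2 ^ n ℕ.* 16)             ≡⟨ ℕ.*-comm 4 (2 ^ n ℕ.* 16) ⟩
  2 ^ n ℕ.* 16 ℕ.* 4               ≡⟨ ℕ.*-assoc (2 ^ n) 16 4 ⟩
  2 ^ n ℕ.* 64                     ≡⟨ ℕ.*-comm (2 ^ n) 64 ⟩
  64 ℕ.* 2 ^ n                     ∎)
  where
  open ℕ.≤-Reasoning
  10≤2^n : 10 ≤ 2 ^ n
  10≤2^n = ℕ.≤-trans (ℕ.m≤m+n 10 6) (ℕ.^-monoʳ-≤ 2 (ℕ.m≤m+n 4 k))
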